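{- Let $\zeta,\eta\ge1$ and $m,n\ge0$ be integers, and let $t\ge3$ be an odd integer. Then $\overline{S}_t^{\,2^\zeta m+\eta}(n)\equiv\overline{S}_t^{\,\eta}(n)\pmod{2^{\zeta+1}}$.
   Context: For $|q|<1$ and a positive integer $k$, write $f_k=\prod_{j\ge1}(1-q^{kj})$. For an odd integer $t\ge3$ and a positive integer $r$, the number $\overline{S}_t^{\,r}(n)$ of $t$-Schur overpartitions of $n$ with $r$-tuples is defined by $\sum_{n\ge0}\overline{S}_t^{\,r}(n)q^n=\prod_{n\ge1}\frac{(1+q^{2n-1})^r(1-q^{t(2n-1)})^r}{(1+q^{t(2n-1)})^r(1-q^{2n-1})^r}=\frac{f_2^{3r}f_t^{2r}f_{4t}^r}{f_1^{2r}f_4^rf_{2t}^{3r}}$. -}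

module Defs where

open import Data.Nat as ℕ using (ℕ; zero; suc; _∸_)
open import Data.Nat.Divisibility using (_∣?_)
open import Data.Integer as ℤ using (ℤ; +_; -_; _+_; _*_)
open import Relation.Nullary using (does)
open import Data.Bool using (if_then_else_)

Series : Set
Series = ℕ → ℤ

sumTo : ℕ → (ℕ → ℤ) → ℤ
sumTo zero    g = g 0
sumTo (suc n) g = sumTo n g + g (suc n)

_⊛_ : Series → Series → Series
(a ⊛ b) n = sumTo n (λ i → a i * b (n ∸ i))

one : Series
one zero    = + 1
one (suc _) = + 0

_^ˢ_ : Series → ℕ → Series
a ^ˢ zero  = one
a ^ˢ suc r = a ⊛ (a ^ˢ r)

-- 1 - q^m   (used with m ≥ 1)
oneMinusPow : ℕ → Series
oneMinusPow m zero    = + 1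
oneMinusPow m (suc n) = if does (m ℕ.≟ suc n) then - (+ 1) else + 0

-- 1 / (1 - q^m) = Σ_{i ≥ 0} q^{m i}   (used with m ≥ 1)
geomPow : ℕ → Series
geomPow m n = if does (m ∣? n) then + 1 else + 0

prodUpTo : ℕ → ℕ → Series
prodUpTo k zero    = one
prodUpTo k (suc N) = prodUpTo k N ⊛ oneMinusPow (k ℕ.* suc N)

invProdUpTo : ℕ → ℕ → Series
invProdUpTo k zero    = one
invProdUpTo k (suc N) = invProdUpTo k N ⊛ geomPow (k ℕ.* suc N)

-- f_k = ∏_{j≥1} (1 - q^{kj})  (k ≥ 1). The coefficient of q^n only involves
-- factors with j ≤ n, so it equals that of the finite product up to j = n.
f : ℕ → Series
f k n = prodUpTo k n n

-- 1 / f_k = ∏_{j≥1} 1/(1 - q^{kj})  (k ≥ 1), same truncation remark.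
finv : ℕ → Series
finv k n = invProdUpTo k n n

-- Generating function of t-Schur overpartitions with r-tuples:
--   f_2^{3r} f_t^{2r} f_{4t}^r / (f_1^{2r} f_4^r f_{2t}^{3r})
Sbar-series : ℕ → ℕ → Series
Sbar-series t r =
  (f 2 ^ˢ (3 ℕ.* r)) ⊛ ((f t ^ˢ (2 ℕ.* r)) ⊛ ((f (4 ℕ.* t) ^ˢ r) ⊛
  ((finv 1 ^ˢ (2 ℕ.* r)) ⊛ ((finv 4 ^ˢ r) ⊛ (finv (2 ℕ.* t) ^ˢ (3 ℕ.* r))))))

Sbar : ℕ → ℕ → ℕ → ℤ
Sbar t r n = Sbar-series t r n

module Submission where

-- Let G be the generating function for r = 1; the one for r-tuples is G^r. Since
-- (1 - q^j)² ≡ 1 - q^(2j) (mod 2), we have f_k² ≡ f_(2k) (mod 2), and grouping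
--   G = (f_2² / f_4) (f_t² / f_(2t)) (f_2 / f_1²) (f_(4t) / f_(2t)²)
-- shows G ≡ 1 (mod 2). Squaring lifts such congruences: if x ≡ 1 (mod 2^k) with k ≥ 1,
-- then x² - 1 = (x - 1)(x + 1) ≡ 0 (mod 2^(k+1)). Hence G^(2^ζ) ≡ 1 (mod 2^(ζ+1)), and
-- G^(2^ζ m + η) = (G^(2^ζ))^m G^η ≡ G^η.

open import Defs

module PowerSeries where
  open import Data.Nat as ℕ
    using (ℕ; zero; suc; _∸_; _≤_; _<_; _≤′_; ≤′-refl; ≤′-step; z≤n; s≤s; _^_)
  import Data.Nat.Properties as ℕ
  open import Data.Nat.Divisibility as ℕ∣ using (_∣?_)
  open import Data.Integer as ℤ using (ℤ; +_; -_; _+_; _*_; _-_)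
  import Data.Integer.Properties as ℤ
  open import Data.Integer.Divisibility.Signed
    using (_∣_; divides; ∣ᵤ⇒∣; ∣-trans; ∣m∣n⇒∣m+n; ∣m⇒∣-m; ∣m⇒∣m*n; *-monoʳ-∣; *-monoˡ-∣)
  open import Data.Integer.Tactic.RingSolver using (solve-∀)
  open import Data.Nat.Tactic.RingSolver using () renaming (solve-∀ to ℕ-solve-∀)
  open import Algebra.Bundles using (CommutativeRing)
  open import Data.Product using (_,_)
  open import Data.Fin using (#_)
  open import Data.Vec using ([]; _∷_)
  open import Function using (_∘_)
  open import Level using (0ℓ)
  open import Relation.Binary.Structures using (IsEquivalence)
  open import Relation.Binary.PropositionalEquality
    using (_≡_; refl; sym; trans; cong; cong₂; subst; _≗_; module ≡-Reasoning)
  open import Relation.Nullary using (yes; no; contradiction)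
  open import Relation.Nullary.Decidable using (dec-false)
  open import Data.Bool using (if_then_else_)

  infixl 6 _+ˢ_ _-ˢ_
  infix  8 -ˢ_
  infixr 7 _•ˢ_
  infix  25 q^_

  _+ˢ_ _-ˢ_ : Series → Series → Series
  (a +ˢ b) n = a n + b n
  (a -ˢ b) n = a n - b n

  -ˢ_ : Series → Series
  (-ˢ a) n = - a n

  0ˢ : Series
  0ˢ _ = + 0

  _•ˢ_ : ℤ → Series → Series
  (k •ˢ a) n = k * a n

  tail : Series → Series
  tail a n = a (suc n)

  shift : ℕ → Series → Series
  shift zero    a         = a
  shift (suc m) a zero    = + 0
  shift (suc m) a (suc n) = shift m a n

  q^_ : ℕ → Series
  q^ m = shift m one

  sumTo-cong : ∀ n {g h : ℕ → ℤ} → (∀ i → i ≤ n → g i ≡ h i) → sumTo n g ≡ sumTo n h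
  sumTo-cong zero    g≡h = g≡h 0 z≤n
  sumTo-cong (suc n) g≡h =
    cong₂ _+_ (sumTo-cong n (λ i i≤n → g≡h i (ℕ.m≤n⇒m≤1+n i≤n))) (g≡h (suc n) ℕ.≤-refl)

  sumTo-+ : ∀ n (g h : ℕ → ℤ) → sumTo n (λ i → g i + h i) ≡ sumTo n g + sumTo n h
  sumTo-+ zero    g h = refl
  sumTo-+ (suc n) g h = trans (cong (_+ (g (suc n) + h (suc n))) (sumTo-+ n g h))
    (interchange (sumTo n g) (sumTo n h) (g (suc n)) (h (suc n)))
    where
    interchange : ∀ a b c d → (a + b) + (c + d) ≡ (a + c) + (b + d)
    interchange = solve-∀

  sumTo-* : ∀ n k (g : ℕ → ℤ) → sumTo n (λ i → k * g i) ≡ k * sumTo n g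
  sumTo-* zero    k g = refl
  sumTo-* (suc n) k g = trans (cong (_+ k * g (suc n)) (sumTo-* n k g))
    (sym (ℤ.*-distribˡ-+ k (sumTo n g) (g (suc n))))

  sumTo-suc : ∀ n (g : ℕ → ℤ) → sumTo (suc n) g ≡ g 0 + sumTo n (g ∘ suc)
  sumTo-suc zero    g = refl
  sumTo-suc (suc n) g = trans (cong (_+ g (suc (suc n))) (sumTo-suc n g)) (ℤ.+-assoc (g 0) _ _)

  ⊛-suc : ∀ a b n → (a ⊛ b) (suc n) ≡ a 0 * b (suc n) + (tail a ⊛ b) n
  ⊛-suc a b n = sumTo-suc n (λ i → a i * b (suc n ∸ i))

  ⊛-sucʳ : ∀ a b n → (a ⊛ b) (suc n) ≡ (a ⊛ tail b) n + a (suc n) * b 0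
  ⊛-sucʳ a b n = cong₂ _+_
    (sumTo-cong n (λ i i≤n → cong (λ j → a i * b j) (ℕ.+-∸-assoc 1 i≤n)))
    (cong (λ j → a (suc n) * b j) (ℕ.n∸n≡0 n))

  ⊛-local : ∀ {a a' b b'} n → (∀ i → i ≤ n → a i ≡ a' i) → (∀ i → i ≤ n → b i ≡ b' i) →
            (a ⊛ b) n ≡ (a' ⊛ b') n
  ⊛-local n a≡a' b≡b' =
    sumTo-cong n (λ i i≤n → cong₂ _*_ (a≡a' i i≤n) (b≡b' (n ∸ i) (ℕ.m∸n≤m n i)))

  ⊛-cong : ∀ {a a' b b'} → a ≗ a' → b ≗ b' → a ⊛ b ≗ a' ⊛ b'
  ⊛-cong a≗a' b≗b' n = ⊛-local n (λ i _ → a≗a' i) (λ i _ → b≗b' i)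

  ⊛-comm : ∀ a b → a ⊛ b ≗ b ⊛ a
  ⊛-comm a b zero    = ℤ.*-comm (a 0) (b 0)
  ⊛-comm a b (suc n) = begin
    (a ⊛ b) (suc n)                   ≡⟨ ⊛-suc a b n ⟩
    a 0 * b (suc n) + (tail a ⊛ b) n  ≡⟨ cong₂ _+_ (ℤ.*-comm (a 0) _) (⊛-comm (tail a) b n) ⟩
    b (suc n) * a 0 + (b ⊛ tail a) n  ≡⟨ ℤ.+-comm (b (suc n) * a 0) _ ⟩
    (b ⊛ tail a) n + b (suc n) * a 0  ≡⟨ ⊛-sucʳ b a n ⟨
    (b ⊛ a) (suc n)                   ∎
    where open ≡-Reasoning

  ⊛-distribʳ : ∀ a b c → (b +ˢ c) ⊛ a ≗ b ⊛ a +ˢ c ⊛ a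
  ⊛-distribʳ a b c n =
    trans (sumTo-cong n (λ i _ → ℤ.*-distribʳ-+ (a (n ∸ i)) (b i) (c i))) (sumTo-+ n _ _)

  ⊛-distribʳ-minus : ∀ a b c → (b -ˢ c) ⊛ a ≗ b ⊛ a -ˢ c ⊛ a
  ⊛-distribʳ-minus a b c n = begin
    ((b -ˢ c) ⊛ a) n             ≡⟨ add-sub _ ca ⟨
    ((b -ˢ c) ⊛ a) n + ca - ca   ≡⟨ cong (_- ca) (⊛-distribʳ a (b -ˢ c) c n) ⟨
    ((b -ˢ c +ˢ c) ⊛ a) n - ca   ≡⟨ cong (_- ca) (⊛-cong {b = a} sub-add (λ _ → refl) n) ⟩
    (b ⊛ a) n - ca               ∎
    where
    open ≡-Reasoning
    ca = (c ⊛ a) n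
    add-sub : ∀ x y → x + y - y ≡ x
    add-sub = solve-∀
    sub-add : b -ˢ c +ˢ c ≗ b
    sub-add i = sub-add′ (b i) (c i)
      where
      sub-add′ : ∀ x y → x - y + y ≡ x
      sub-add′ = solve-∀

  ⊛-•ˢ : ∀ k a b → (k •ˢ a) ⊛ b ≗ k •ˢ (a ⊛ b)
  ⊛-•ˢ k a b n = trans (sumTo-cong n (λ i _ → ℤ.*-assoc k (a i) _)) (sumTo-* n k _)

  ⊛-identityˡ : ∀ a → one ⊛ a ≗ a
  ⊛-identityˡ a zero    = ℤ.*-identityˡ (a 0)
  ⊛-identityˡ a (suc n) = begin
    (one ⊛ a) (suc n)             ≡⟨ ⊛-suc one a n ⟩
    + 1 * a (suc n) + (0ˢ ⊛ a) n
      ≡⟨ cong₂ _+_ (ℤ.*-identityˡ (a (suc n))) (⊛-•ˢ (+ 0) 0ˢ a n) ⟩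
    a (suc n) + + 0               ≡⟨ ℤ.+-identityʳ _ ⟩
    a (suc n)                     ∎
    where open ≡-Reasoning

  ⊛-identityʳ : ∀ a → a ⊛ one ≗ a
  ⊛-identityʳ a n = trans (⊛-comm a one n) (⊛-identityˡ a n)

  ⊛-distribˡ : ∀ a b c → a ⊛ (b +ˢ c) ≗ a ⊛ b +ˢ a ⊛ c
  ⊛-distribˡ a b c n = trans (⊛-comm a (b +ˢ c) n)
    (trans (⊛-distribʳ a b c n) (cong₂ _+_ (⊛-comm b a n) (⊛-comm c a n)))

  -- Induction on the degree, using tail (a ⊛ b) ≗ a 0 •ˢ tail b +ˢ tail a ⊛ b.
  ⊛-assoc : ∀ a b c → (a ⊛ b) ⊛ c ≗ a ⊛ (b ⊛ c)
  ⊛-assoc a b c zero    = ℤ.*-assoc (a 0) (b 0) (c 0)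
  ⊛-assoc a b c (suc n) = begin
    ((a ⊛ b) ⊛ c) (suc n)
      ≡⟨ ⊛-suc (a ⊛ b) c n ⟩
    a 0 * b 0 * c (suc n) + (tail (a ⊛ b) ⊛ c) n
      ≡⟨ cong (_+_ (a 0 * b 0 * c (suc n))) tail-step ⟩
    a 0 * b 0 * c (suc n) + (a 0 * (tail b ⊛ c) n + (tail a ⊛ (b ⊛ c)) n)
      ≡⟨ regroup (a 0) (b 0) (c (suc n)) _ _ ⟩
    a 0 * (b 0 * c (suc n) + (tail b ⊛ c) n) + (tail a ⊛ (b ⊛ c)) n
      ≡⟨ cong (λ z → a 0 * z + (tail a ⊛ (b ⊛ c)) n) (⊛-suc b c n) ⟨
    a 0 * (b ⊛ c) (suc n) + (tail a ⊛ (b ⊛ c)) n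
      ≡⟨ ⊛-suc a (b ⊛ c) n ⟨
    (a ⊛ (b ⊛ c)) (suc n)
      ∎
    where
    open ≡-Reasoning
    regroup : ∀ x y z u v → x * y * z + (x * u + v) ≡ x * (y * z + u) + v
    regroup = solve-∀
    tail-step : (tail (a ⊛ b) ⊛ c) n ≡ a 0 * (tail b ⊛ c) n + (tail a ⊛ (b ⊛ c)) n
    tail-step = begin
      (tail (a ⊛ b) ⊛ c) n
        ≡⟨ ⊛-cong {b = c} (⊛-suc a b) (λ _ → refl) n ⟩
      ((a 0 •ˢ tail b +ˢ tail a ⊛ b) ⊛ c) n
        ≡⟨ ⊛-distribʳ c (a 0 •ˢ tail b) (tail a ⊛ b) n ⟩
      ((a 0 •ˢ tail b) ⊛ c) n + ((tail a ⊛ b) ⊛ c) n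
        ≡⟨ cong₂ _+_ (⊛-•ˢ (a 0) (tail b) c n) (⊛-assoc (tail a) b c n) ⟩
      a 0 * (tail b ⊛ c) n + (tail a ⊛ (b ⊛ c)) n
        ∎

  shift-< : ∀ {m n} a → n < m → shift m a n ≡ + 0
  shift-< {suc m} {zero}  a _           = refl
  shift-< {suc m} {suc n} a (s≤s n<m) = shift-< a n<m

  shift-+ : ∀ m a k → shift m a (m ℕ.+ k) ≡ a k
  shift-+ zero    a k = refl
  shift-+ (suc m) a k = shift-+ m a k

  shift-shift : ∀ m m' a → shift m (shift m' a) ≗ shift (m ℕ.+ m') a
  shift-shift zero    m' a n       = refl
  shift-shift (suc m) m' a zero    = refl
  shift-shift (suc m) m' a (suc n) = shift-shift m m' a n

  q^-⊛ : ∀ m a → q^ m ⊛ a ≗ shift m a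
  q^-⊛ zero    a n       = ⊛-identityˡ a n
  q^-⊛ (suc m) a zero    = refl
  q^-⊛ (suc m) a (suc n) = trans (⊛-suc (q^ suc m) a n) (trans (ℤ.+-identityˡ _) (q^-⊛ m a n))

  q^-+ : ∀ m m' → q^ m ⊛ q^ m' ≗ q^ (m ℕ.+ m')
  q^-+ m m' n = trans (q^-⊛ m (q^ m') n) (shift-shift m m' one n)

  oneMinusPow-≗ : ∀ m → oneMinusPow (suc m) ≗ one -ˢ q^ suc m
  oneMinusPow-≗ m zero    = refl
  oneMinusPow-≗ m (suc n) = trans (coeff m n) (sym (ℤ.+-identityˡ _))
    where
    coeff : ∀ m n → oneMinusPow (suc m) (suc n) ≡ - (q^ m) n
    coeff zero    zero    = refl
    coeff zero    (suc n) = refl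
    coeff (suc m) zero    = refl
    coeff (suc m) (suc n) = coeff m n

  oneMinusPow-< : ∀ {m n} → n < m → oneMinusPow m n ≡ one n
  oneMinusPow-< {m} {zero}  _ = refl
  oneMinusPow-< {m} {suc n} n<m =
    cong (if_then - + 1 else + 0) (dec-false (m ℕ.≟ suc n) λ { refl → ℕ.<-irrefl refl n<m })

  geomPow-< : ∀ {m n} → n < m → geomPow m n ≡ one n
  geomPow-< {m} {zero}  _ with m ∣? 0
  ... | yes _   = refl
  ... | no  m∤0 = contradiction (m ℕ∣.∣0) m∤0
  geomPow-< {m} {suc n} n<m with m ∣? suc n
  ... | yes m∣n = contradiction (ℕ∣.∣⇒≤ m∣n) (ℕ.<⇒≱ n<m)
  ... | no  _   = refl

  geomPow-+ : ∀ m k → geomPow m (m ℕ.+ k) ≡ geomPow m k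
  geomPow-+ m k with m ∣? (m ℕ.+ k) | m ∣? k
  ... | yes _     | yes _   = refl
  ... | no  _     | no  _   = refl
  ... | yes m∣m+k | no  m∤k = contradiction (ℕ∣.∣m+n∣m⇒∣n m∣m+k ℕ∣.∣-refl) m∤k
  ... | no  m∤m+k | yes m∣k = contradiction (ℕ∣.∣m∣n⇒∣m+n ℕ∣.∣-refl m∣k) m∤m+k

  -- The coefficients of geomPow m are m-periodic, so subtracting the shifted copy leaves only q^0.
  geomPow-shift : ∀ m → geomPow (suc m) -ˢ shift (suc m) (geomPow (suc m)) ≗ one
  geomPow-shift m n with n ℕ.<? suc m
  ... | yes n<m = trans (cong₂ _-_ (geomPow-< n<m) (shift-< g n<m)) (ℤ.+-identityʳ (one n))
    where g = geomPow (suc m)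
  ... | no  n≮m =
    subst (λ n → g n - shift (suc m) g n ≡ one n) (ℕ.m+[n∸m]≡n (ℕ.≮⇒≥ n≮m)) beyond
    where
    g = geomPow (suc m)
    beyond : g (suc m ℕ.+ (n ∸ suc m)) - shift (suc m) g (suc m ℕ.+ (n ∸ suc m)) ≡ + 0
    beyond = trans (cong₂ _-_ (geomPow-+ (suc m) _) (shift-+ (suc m) g _)) (ℤ.+-inverseʳ (g (n ∸ suc m)))

  oneMinusPow-⊛-geomPow : ∀ m → oneMinusPow (suc m) ⊛ geomPow (suc m) ≗ one
  oneMinusPow-⊛-geomPow m n = begin
    (oneMinusPow (suc m) ⊛ g) n        ≡⟨ ⊛-cong {b = g} (oneMinusPow-≗ m) (λ _ → refl) n ⟩
    ((one -ˢ q^ suc m) ⊛ g) n          ≡⟨ ⊛-distribʳ-minus g one (q^ suc m) n ⟩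
    (one ⊛ g) n - (q^ suc m ⊛ g) n     ≡⟨ cong₂ _-_ (⊛-identityˡ g n) (q^-⊛ (suc m) g n) ⟩
    g n - shift (suc m) g n            ≡⟨ geomPow-shift m n ⟩
    one n                              ∎
    where
    open ≡-Reasoning
    g = geomPow (suc m)

  <-factor-degree : ∀ k {j N} → j ≤ N → j < suc k ℕ.* suc N
  <-factor-degree k {N = N} j≤N = ℕ.≤-trans (s≤s j≤N) (ℕ.m≤n*m (suc N) (suc k))

  -- P N and P (N + 1) agree up to degree N, so the diagonal n ↦ P n n is the limit of P.
  Stable : (ℕ → Series) → Set
  Stable P = ∀ {N i} → i ≤ N → P (suc N) i ≡ P N i

  diagonal : (ℕ → Series) → Series
  diagonal P n = P n n

  stable⇒≡diagonal : ∀ {P} → Stable P → ∀ {N i} → i ≤ N → P N i ≡ diagonal P i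
  stable⇒≡diagonal {P} stable i≤N = go (ℕ.≤⇒≤′ i≤N)
    where
    go : ∀ {N i} → i ≤′ N → P N i ≡ P i i
    go ≤′-refl           = refl
    go (≤′-step i≤′N) = trans (stable (ℕ.≤′⇒≤ i≤′N)) (go i≤′N)

  diagonal-⊛ : ∀ {P Q} → Stable P → Stable Q →
               ∀ n → (diagonal P ⊛ diagonal Q) n ≡ (P n ⊛ Q n) n
  diagonal-⊛ P-stable Q-stable n = ⊛-local n
    (λ i i≤n → sym (stable⇒≡diagonal P-stable i≤n))
    (λ i i≤n → sym (stable⇒≡diagonal Q-stable i≤n))

  ⊛-identityʳ-upTo : ∀ a u n → (∀ j → j ≤ n → u j ≡ one j) → (a ⊛ u) n ≡ a n
  ⊛-identityʳ-upTo a u n u≡1 = trans (⊛-local {a} {a} n (λ _ _ → refl) u≡1) (⊛-identityʳ a n)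

  -- The factor added at step N + 1 is 1 + O(q^(k (N + 1))), and N < k (N + 1).
  prodUpTo-stable : ∀ k → Stable (prodUpTo (suc k))
  prodUpTo-stable k {N} i≤N = ⊛-identityʳ-upTo (prodUpTo (suc k) N) _ _ λ j j≤i →
    oneMinusPow-< (<-factor-degree k (ℕ.≤-trans j≤i i≤N))

  invProdUpTo-stable : ∀ k → Stable (invProdUpTo (suc k))
  invProdUpTo-stable k {N} i≤N = ⊛-identityʳ-upTo (invProdUpTo (suc k) N) _ _ λ j j≤i →
    geomPow-< (<-factor-degree k (ℕ.≤-trans j≤i i≤N))

  infix 4 _∣ˢ_

  _∣ˢ_ : ℤ → Series → Set
  M ∣ˢ a = ∀ n → M ∣ a n

  ∣-subst : ∀ {M x y} → x ≡ y → M ∣ x → M ∣ y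
  ∣-subst = subst (_ ∣_)

  sumTo-∣ : ∀ {M} n (g : ℕ → ℤ) → (∀ i → M ∣ g i) → M ∣ sumTo n g
  sumTo-∣ zero    g M∣g = M∣g 0
  sumTo-∣ (suc n) g M∣g = ∣m∣n⇒∣m+n (sumTo-∣ n g M∣g) (M∣g (suc n))

  ∣ˢ-⊛ : ∀ {M a} b → M ∣ˢ a → M ∣ˢ a ⊛ b
  ∣ˢ-⊛ b M∣a n = sumTo-∣ n _ (λ i → ∣m⇒∣m*n (b (n ∸ i)) (M∣a i))

  ∣ˢ-⊛-∣ˢ : ∀ {M N a b} → M ∣ˢ a → N ∣ˢ b → M * N ∣ˢ a ⊛ b
  ∣ˢ-⊛-∣ˢ {M} {b = b} M∣a N∣b n = sumTo-∣ n _ λ i →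
    ∣-trans (*-monoʳ-∣ M (N∣b (n ∸ i))) (*-monoˡ-∣ (b (n ∸ i)) (M∣a i))

  record Congruent {M : ℤ} (a b : Series) : Set where
    constructor coeffwise
    field ∣-coeff : M ∣ˢ a -ˢ b
  open Congruent public

  infix 4 Congruent
  syntax Congruent {M = M} a b = a ≡ b [mod M ]

  ≗⇒≡[mod] : ∀ {M a b} → a ≗ b → a ≡ b [mod M ]
  ≗⇒≡[mod] {M} {b = b} a≗b = coeffwise λ n → ∣-subst (cong (_- b n) (sym (a≗b n))) (M∣0 (b n))
    where
    M∣0 : ∀ x → M ∣ x - x
    M∣0 x = divides (+ 0) (trans (ℤ.+-inverseʳ x) (sym (ℤ.*-zeroˡ M)))

  ≡[mod]-sym : ∀ {M a b} → a ≡ b [mod M ] → b ≡ a [mod M ]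
  ≡[mod]-sym {a = a} {b} (coeffwise M∣a-b) = coeffwise λ n →
    ∣-subst (negate-difference (a n) (b n)) (∣m⇒∣-m (M∣a-b n))
    where
    negate-difference : ∀ x y → - (x - y) ≡ y - x
    negate-difference = solve-∀

  ≡[mod]-trans : ∀ {M a b c} → a ≡ b [mod M ] → b ≡ c [mod M ] → a ≡ c [mod M ]
  ≡[mod]-trans {a = a} {b} {c} (coeffwise M∣a-b) (coeffwise M∣b-c) = coeffwise λ n →
    ∣-subst (telescope (a n) (b n) (c n)) (∣m∣n⇒∣m+n (M∣a-b n) (M∣b-c n))
    where
    telescope : ∀ x y z → (x - y) + (y - z) ≡ x - z
    telescope = solve-∀

  ≡[mod]-isEquivalence : ∀ {M} → IsEquivalence (Congruent {M})
  ≡[mod]-isEquivalence = record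
    { refl = ≗⇒≡[mod] (λ _ → refl) ; sym = ≡[mod]-sym ; trans = ≡[mod]-trans }

  ∣ˢ⇒≡0 : ∀ {M a} → M ∣ˢ a → a ≡ 0ˢ [mod M ]
  ∣ˢ⇒≡0 {a = a} M∣a = coeffwise λ n → ∣-subst (sym (ℤ.+-identityʳ (a n))) (M∣a n)

  +ˢ-cong : ∀ {M a a' b b'} → a ≡ a' [mod M ] → b ≡ b' [mod M ] → a +ˢ b ≡ a' +ˢ b' [mod M ]
  +ˢ-cong {a = a} {a'} {b} {b'} (coeffwise M∣a-a') (coeffwise M∣b-b') = coeffwise λ n →
    ∣-subst (interchange (a n) (a' n) (b n) (b' n)) (∣m∣n⇒∣m+n (M∣a-a' n) (M∣b-b' n))
    where
    interchange : ∀ x x' y y' → (x - x') + (y - y') ≡ (x + y) - (x' + y')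
    interchange = solve-∀

  -ˢ-cong : ∀ {M a a'} → a ≡ a' [mod M ] → -ˢ a ≡ -ˢ a' [mod M ]
  -ˢ-cong {a = a} {a'} (coeffwise M∣a-a') = coeffwise λ n →
    ∣-subst (negate-difference (a n) (a' n)) (∣m⇒∣-m (M∣a-a' n))
    where
    negate-difference : ∀ x y → - (x - y) ≡ - x - - y
    negate-difference = solve-∀

  ⊛-congʳ[mod] : ∀ {M a a'} b → a ≡ a' [mod M ] → a ⊛ b ≡ a' ⊛ b [mod M ]
  ⊛-congʳ[mod] {a = a} {a'} b (coeffwise M∣a-a') = coeffwise λ n →
    ∣-subst (⊛-distribʳ-minus b a a' n) (∣ˢ-⊛ b M∣a-a' n)

  series-commutativeRing : ℤ → CommutativeRing 0ℓ 0ℓ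
  series-commutativeRing M = record
    { Carrier = Series
    ; _≈_ = Congruent {M}
    ; _+_ = _+ˢ_
    ; _*_ = _⊛_
    ; -_ = -ˢ_
    ; 0# = 0ˢ
    ; 1# = one
    ; isCommutativeRing = record
      { isRing = record
        { +-isAbelianGroup = record
          { isGroup = record
            { isMonoid = record
              { isSemigroup = record
                { isMagma = record { isEquivalence = ≡[mod]-isEquivalence ; ∙-cong = +ˢ-cong }
                ; assoc = λ a b c → ≗⇒≡[mod] λ n → ℤ.+-assoc (a n) (b n) (c n)
                }
              ; identity = (λ a → ≗⇒≡[mod] (ℤ.+-identityˡ ∘ a))
                         , (λ a → ≗⇒≡[mod] (ℤ.+-identityʳ ∘ a))
              }
            ; inverse = (λ a → ≗⇒≡[mod] (ℤ.+-inverseˡ ∘ a))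
                      , (λ a → ≗⇒≡[mod] (ℤ.+-inverseʳ ∘ a))
            ; ⁻¹-cong = -ˢ-cong
            }
          ; comm = λ a b → ≗⇒≡[mod] λ n → ℤ.+-comm (a n) (b n)
          }
        ; *-cong = λ {a} {a'} {b} {b'} a≡a' b≡b' →
            ≡[mod]-trans (⊛-congʳ[mod] b a≡a')
              (≡[mod]-trans (*-comm a' b) (≡[mod]-trans (⊛-congʳ[mod] a' b≡b') (*-comm b' a')))
        ; *-assoc = λ a b c → ≗⇒≡[mod] (⊛-assoc a b c)
        ; *-identity = (λ a → ≗⇒≡[mod] (⊛-identityˡ a)) , (λ a → ≗⇒≡[mod] (⊛-identityʳ a))
        ; distrib = (λ a b c → ≗⇒≡[mod] (⊛-distribˡ a b c))
                  , (λ a b c → ≗⇒≡[mod] (⊛-distribʳ a b c))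
        }
      ; *-comm = *-comm
      }
    }
    where
    *-comm : ∀ a b → a ⊛ b ≡ b ⊛ a [mod M ]
    *-comm a b = ≗⇒≡[mod] (⊛-comm a b)

  -- Exact identities are proved modulo an arbitrary M, so that they are available in every quotient.
  module SeriesMod (M : ℤ) where

    open CommutativeRing (series-commutativeRing M) public
      using ( _≈_; setoid; reflexive; *-cong; *-congʳ; *-identityˡ; +-congˡ; +-identityʳ
            ; commutativeSemiring; *-commutativeSemigroup; *-commutativeMonoid)
      renaming (refl to ≈-refl)
    open import Algebra.Properties.CommutativeSemiring.Exp commutativeSemiring
      using (^-homo-*; ^-assocʳ; ^-distrib-*) renaming (_^_ to _^ʳ_)
    open import Algebra.Properties.CommutativeSemigroup *-commutativeSemigroup public
      using (interchange)
    open import Relation.Binary.Reasoning.Setoid setoid public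

    ^ˢ≡^ʳ : ∀ a n → a ^ˢ n ≡ a ^ʳ n
    ^ˢ≡^ʳ a zero    = refl
    ^ˢ≡^ʳ a (suc n) = cong (a ⊛_) (^ˢ≡^ʳ a n)

    ^ˢ-homo-⊛ : ∀ a m n → a ^ˢ (m ℕ.+ n) ≈ (a ^ˢ m) ⊛ (a ^ˢ n)
    ^ˢ-homo-⊛ a m n rewrite ^ˢ≡^ʳ a (m ℕ.+ n) | ^ˢ≡^ʳ a m | ^ˢ≡^ʳ a n = ^-homo-* a m n

    ^ˢ-assocʳ : ∀ a m n → (a ^ˢ m) ^ˢ n ≈ a ^ˢ (m ℕ.* n)
    ^ˢ-assocʳ a m n rewrite ^ˢ≡^ʳ (a ^ˢ m) n | ^ˢ≡^ʳ a m | ^ˢ≡^ʳ a (m ℕ.* n) = ^-assocʳ a m n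

    ^ˢ-distrib-⊛ : ∀ a b n → (a ⊛ b) ^ˢ n ≈ (a ^ˢ n) ⊛ (b ^ˢ n)
    ^ˢ-distrib-⊛ a b n rewrite ^ˢ≡^ʳ (a ⊛ b) n | ^ˢ≡^ʳ a n | ^ˢ≡^ʳ b n = ^-distrib-* a b n

    x≈1∧y≈1⇒x⊛y≈1 : ∀ {x y} → x ≈ one → y ≈ one → x ⊛ y ≈ one
    x≈1∧y≈1⇒x⊛y≈1 {x} {y} x≈1 y≈1 = begin
      x ⊛ y      ≈⟨ *-cong x≈1 y≈1 ⟩
      one ⊛ one  ≈⟨ *-identityˡ one ⟩
      one        ∎

    x≈1⇒x^ˢn≈1 : ∀ {x} n → x ≈ one → x ^ˢ n ≈ one
    x≈1⇒x^ˢn≈1 zero    x≈1 = reflexive refl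
    x≈1⇒x^ˢn≈1 (suc n) x≈1 = x≈1∧y≈1⇒x⊛y≈1 x≈1 (x≈1⇒x^ˢn≈1 n x≈1)

    diagonal-⊛-≈ : ∀ {P Q R} → Stable P → Stable Q → (∀ N → P N ⊛ Q N ≈ R N) →
                   diagonal P ⊛ diagonal Q ≈ diagonal R
    diagonal-⊛-≈ {R = R} P-stable Q-stable PQ≈R = coeffwise λ n →
      ∣-subst (cong (_- R n n) (sym (diagonal-⊛ P-stable Q-stable n))) (∣-coeff (PQ≈R n) n)

    prodUpTo-⊛-invProdUpTo : ∀ k N → prodUpTo (suc k) N ⊛ invProdUpTo (suc k) N ≈ one
    prodUpTo-⊛-invProdUpTo k zero    = *-identityˡ one
    prodUpTo-⊛-invProdUpTo k (suc N) = begin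
      (P ⊛ oneMinusPow m) ⊛ (I ⊛ geomPow m)  ≈⟨ interchange P (oneMinusPow m) I (geomPow m) ⟩
      (P ⊛ I) ⊛ (oneMinusPow m ⊛ geomPow m)  ≈⟨ x≈1∧y≈1⇒x⊛y≈1 (prodUpTo-⊛-invProdUpTo k N)
                                                  (≗⇒≡[mod] (oneMinusPow-⊛-geomPow _)) ⟩
      one                                    ∎
      where
      P = prodUpTo (suc k) N
      I = invProdUpTo (suc k) N
      m = suc k ℕ.* suc N

    f-⊛-finv : ∀ k → f (suc k) ⊛ finv (suc k) ≈ one
    f-⊛-finv k = diagonal-⊛-≈ (prodUpTo-stable k) (invProdUpTo-stable k) (prodUpTo-⊛-invProdUpTo k)

    Sbar-series-^ˢ : ∀ t r → Sbar-series t 1 ^ˢ r ≈ Sbar-series t r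
    Sbar-series-^ˢ t r =
      pull-out (f 2)          3 refl               (
      pull-out (f t)          2 refl               (
      pull-out (f (4 ℕ.* t))  1 (ℕ.*-identityˡ r)  (
      pull-out (finv 1)       2 refl               (
      pull-out (finv 4)       1 (ℕ.*-identityˡ r)  (
      ^ˢ-assocʳ (finv (2 ℕ.* t)) 3 r)))))
      where
      pull-out : ∀ a c {cr x y} → c ℕ.* r ≡ cr → x ^ˢ r ≈ y →
                 ((a ^ˢ c) ⊛ x) ^ˢ r ≈ (a ^ˢ cr) ⊛ y
      pull-out a c {x = x} {y} refl x^r≈y = begin
        ((a ^ˢ c) ⊛ x) ^ˢ r         ≈⟨ ^ˢ-distrib-⊛ (a ^ˢ c) x r ⟩
        ((a ^ˢ c) ^ˢ r) ⊛ (x ^ˢ r)  ≈⟨ *-cong (^ˢ-assocʳ a c r) x^r≈y ⟩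
        (a ^ˢ (c ℕ.* r)) ⊛ y        ∎

  module Mod2 where

    open SeriesMod (+ 2)
    open import Algebra.Solver.Ring.NaturalCoefficients.Default commutativeSemiring
      using (solve; _:+_; _:*_; _:=_; con)

    x+x≈0 : ∀ x → x +ˢ x ≈ 0ˢ
    x+x≈0 x = ∣ˢ⇒≡0 λ n → divides (x n) (twice (x n))
      where
      twice : ∀ y → y + y ≡ y * + 2
      twice = solve-∀

    -x≈x : ∀ x → -ˢ x ≈ x
    -x≈x x = coeffwise λ n → divides (- x n) (twice (x n))
      where
      twice : ∀ y → - y - y ≡ - y * + 2
      twice = solve-∀

    oneMinusPow≈1+q^ : ∀ m → oneMinusPow (suc m) ≈ one +ˢ q^ suc m
    oneMinusPow≈1+q^ m = begin
      oneMinusPow (suc m)  ≈⟨ ≗⇒≡[mod] (oneMinusPow-≗ m) ⟩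
      one -ˢ q^ suc m      ≈⟨ +-congˡ {one} (-x≈x (q^ suc m)) ⟩
      one +ˢ q^ suc m      ∎

    oneMinusPow-square : ∀ m → oneMinusPow (suc m) ⊛ oneMinusPow (suc m) ≈ oneMinusPow (suc m ℕ.+ suc m)
    oneMinusPow-square m = begin
      oneMinusPow (suc m) ⊛ oneMinusPow (suc m)  ≈⟨ *-cong (oneMinusPow≈1+q^ m) (oneMinusPow≈1+q^ m) ⟩
      (one +ˢ μ) ⊛ (one +ˢ μ)                    ≈⟨ square-expand μ ⟩
      (one +ˢ μ ⊛ μ) +ˢ (μ +ˢ μ)                 ≈⟨ +-congˡ {one +ˢ μ ⊛ μ} (x+x≈0 μ) ⟩
      (one +ˢ μ ⊛ μ) +ˢ 0ˢ                       ≈⟨ +-identityʳ _ ⟩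
      one +ˢ μ ⊛ μ                               ≈⟨ +-congˡ {one} (≗⇒≡[mod] (q^-+ (suc m) (suc m))) ⟩
      one +ˢ q^ (suc m ℕ.+ suc m)                ≈⟨ oneMinusPow≈1+q^ (m ℕ.+ suc m) ⟨
      oneMinusPow (suc m ℕ.+ suc m)              ∎
      where
      μ = q^ suc m
      square-expand : ∀ x → (one +ˢ x) ⊛ (one +ˢ x) ≈ (one +ˢ x ⊛ x) +ˢ (x +ˢ x)
      square-expand = solve 1 (λ x → (con 1 :+ x) :* (con 1 :+ x) := (con 1 :+ x :* x) :+ (x :+ x)) ≈-refl

    prodUpTo-square : ∀ k N → prodUpTo (suc k) N ⊛ prodUpTo (suc k) N ≈ prodUpTo (2 ℕ.* suc k) N
    prodUpTo-square k zero    = *-identityˡ one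
    prodUpTo-square k (suc N) = begin
      (P ⊛ o) ⊛ (P ⊛ o)                  ≈⟨ interchange P o P o ⟩
      (P ⊛ P) ⊛ (o ⊛ o)                  ≈⟨ *-cong (prodUpTo-square k N) (oneMinusPow-square _) ⟩
      P² ⊛ oneMinusPow (m ℕ.+ m)
        ≡⟨ cong (λ e → P² ⊛ oneMinusPow e) (double-degree (suc k) (suc N)) ⟩
      P² ⊛ oneMinusPow (2 ℕ.* suc k ℕ.* suc N) ∎
      where
      m = suc k ℕ.* suc N
      P = prodUpTo (suc k) N
      P² = prodUpTo (2 ℕ.* suc k) N
      o = oneMinusPow m
      double-degree : ∀ a b → a ℕ.* b ℕ.+ a ℕ.* b ≡ 2 ℕ.* a ℕ.* b
      double-degree = ℕ-solve-∀

    f-square : ∀ k → f (suc k) ⊛ f (suc k) ≈ f (2 ℕ.* suc k)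
    f-square k = diagonal-⊛-≈ (prodUpTo-stable k) (prodUpTo-stable k) (prodUpTo-square k)

    f²-⊛-finv≈1 : ∀ k → (f (suc k) ⊛ f (suc k)) ⊛ finv (2 ℕ.* suc k) ≈ one
    f²-⊛-finv≈1 k = begin
      (f (suc k) ⊛ f (suc k)) ⊛ finv (2 ℕ.* suc k)  ≈⟨ *-congʳ {finv (2 ℕ.* suc k)} (f-square k) ⟩
      f (2 ℕ.* suc k) ⊛ finv (2 ℕ.* suc k)          ≈⟨ f-⊛-finv _ ⟩
      one                                           ∎

    f-⊛-finv²≈1 : ∀ k → f (2 ℕ.* suc k) ⊛ (finv (suc k) ⊛ finv (suc k)) ≈ one
    f-⊛-finv²≈1 k = begin
      f (2 ℕ.* suc k) ⊛ (d ⊛ d)  ≈⟨ *-congʳ {d ⊛ d} (f-square k) ⟨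
      (a ⊛ a) ⊛ (d ⊛ d)          ≈⟨ interchange a a d d ⟩
      (a ⊛ d) ⊛ (a ⊛ d)          ≈⟨ x≈1∧y≈1⇒x⊛y≈1 (f-⊛-finv k) (f-⊛-finv k) ⟩
      one                        ∎
      where
      a = f (suc k)
      d = finv (suc k)

    Sbar-series≈1 : ∀ t → Sbar-series (suc t) 1 ≈ one
    Sbar-series≈1 t = begin
      Sbar-series (suc t) 1
        ≈⟨ regroup (f 2) (f (suc t)) (f (4 ℕ.* suc t)) (finv 1) (finv 4) (finv (2 ℕ.* suc t)) ⟩
      (((f 2 ⊛ f 2) ⊛ finv 4) ⊛ ((f (suc t) ⊛ f (suc t)) ⊛ finv (2 ℕ.* suc t))) ⊛
      ((f 2 ⊛ (finv 1 ⊛ finv 1)) ⊛ (f (4 ℕ.* suc t) ⊛ (finv (2 ℕ.* suc t) ⊛ finv (2 ℕ.* suc t))))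
        ≈⟨ x≈1∧y≈1⇒x⊛y≈1 (x≈1∧y≈1⇒x⊛y≈1 (f²-⊛-finv≈1 1) (f²-⊛-finv≈1 t))
                          (x≈1∧y≈1⇒x⊛y≈1 (f-⊛-finv²≈1 0) f₄ₜ-pair) ⟩
      one
        ∎
      where
      f₄ₜ-pair : f (4 ℕ.* suc t) ⊛ (finv (2 ℕ.* suc t) ⊛ finv (2 ℕ.* suc t)) ≈ one
      f₄ₜ-pair = subst (λ e → f e ⊛ (finv (2 ℕ.* suc t) ⊛ finv (2 ℕ.* suc t)) ≈ one)
        (sym (ℕ.*-assoc 2 2 (suc t))) (f-⊛-finv²≈1 _)
      regroup : ∀ a b c d e g →
        (a ^ˢ 3) ⊛ ((b ^ˢ 2) ⊛ ((c ^ˢ 1) ⊛ ((d ^ˢ 2) ⊛ ((e ^ˢ 1) ⊛ (g ^ˢ 3))))) ≈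
        (((a ⊛ a) ⊛ e) ⊛ ((b ⊛ b) ⊛ g)) ⊛ ((a ⊛ (d ⊛ d)) ⊛ (c ⊛ (g ⊛ g)))
      regroup a b c d e g = prove 6
        ((a′ ⊕ (a′ ⊕ (a′ ⊕ id))) ⊕ ((b′ ⊕ (b′ ⊕ id)) ⊕ ((c′ ⊕ id) ⊕
          ((d′ ⊕ (d′ ⊕ id)) ⊕ ((e′ ⊕ id) ⊕ (g′ ⊕ (g′ ⊕ (g′ ⊕ id))))))))
        ((((a′ ⊕ a′) ⊕ e′) ⊕ ((b′ ⊕ b′) ⊕ g′)) ⊕
          ((a′ ⊕ (d′ ⊕ d′)) ⊕ (c′ ⊕ (g′ ⊕ g′))))
        (a ∷ b ∷ c ∷ d ∷ e ∷ g ∷ [])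
        where
        open import Algebra.Solver.CommutativeMonoid *-commutativeMonoid using (prove; var; id; _⊕_)
        a′ = var (# 0)
        b′ = var (# 1)
        c′ = var (# 2)
        d′ = var (# 3)
        e′ = var (# 4)
        g′ = var (# 5)

  -- With d = x - 1: x² = 1 + (d + 2) d, and 2 ∣ d + 2 because 2 ∣ N ∣ d.
  square-lift : ∀ {N x} → + 2 ∣ N → x ≡ one [mod N ] → x ⊛ x ≡ one [mod + 2 * N ]
  square-lift {N} {x} 2∣N (coeffwise N∣d) = begin
    x ⊛ x                                ≈⟨ *-cong x≈1+d x≈1+d ⟩
    (one +ˢ d) ⊛ (one +ˢ d)              ≈⟨ square-expand d ⟩
    one +ˢ (d +ˢ (one +ˢ one)) ⊛ d       ≈⟨ +-congˡ {one} (∣ˢ⇒≡0 (∣ˢ-⊛-∣ˢ 2∣d+2 N∣d)) ⟩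
    one +ˢ 0ˢ                            ≈⟨ +-identityʳ one ⟩
    one                                  ∎
    where
    open SeriesMod (+ 2 * N)
    open import Algebra.Solver.Ring.NaturalCoefficients.Default commutativeSemiring
      using (solve; _:+_; _:*_; _:=_; con)
    d = x -ˢ one
    x≈1+d : x ≈ one +ˢ d
    x≈1+d = ≗⇒≡[mod] λ n → add-sub (x n) (one n)
      where
      add-sub : ∀ y z → y ≡ z + (y - z)
      add-sub = solve-∀
    2∣d+2 : + 2 ∣ˢ d +ˢ (one +ˢ one)
    2∣d+2 n = ∣m∣n⇒∣m+n (∣-trans 2∣N (N∣d n)) (divides (one n) (twice (one n)))
      where
      twice : ∀ y → y + y ≡ y * + 2
      twice = solve-∀
    square-expand : ∀ y → (one +ˢ y) ⊛ (one +ˢ y) ≈ one +ˢ (y +ˢ (one +ˢ one)) ⊛ y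
    square-expand = solve 1
      (λ y → (con 1 :+ y) :* (con 1 :+ y) := con 1 :+ (y :+ (con 1 :+ con 1)) :* y) ≈-refl

  pow2-lift : ∀ {x} k → x ≡ one [mod + 2 ] → x ^ˢ (2 ^ k) ≡ one [mod + (2 ^ suc k) ]
  pow2-lift {x} zero    x≡1 = ≡[mod]-trans (≗⇒≡[mod] (⊛-identityʳ x)) x≡1
  pow2-lift {x} (suc k) x≡1 =
    subst (λ N → x ^ˢ (2 ^ suc k) ≡ one [mod N ]) (sym (ℤ.pos-* 2 (2 ^ suc k))) squared
    where
    open SeriesMod (+ 2 * + (2 ^ suc k))
    2∣2^[1+k] : + 2 ∣ + (2 ^ suc k)
    2∣2^[1+k] = ∣ᵤ⇒∣ (ℕ∣.m∣m*n (2 ^ k))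
    squared : x ^ˢ (2 ^ suc k) ≈ one
    squared = begin
      x ^ˢ (2 ^ suc k)                 ≡⟨ cong (λ e → x ^ˢ (2 ^ k ℕ.+ e)) (ℕ.+-identityʳ (2 ^ k)) ⟩
      x ^ˢ (2 ^ k ℕ.+ 2 ^ k)           ≈⟨ ^ˢ-homo-⊛ x (2 ^ k) (2 ^ k) ⟩
      (x ^ˢ (2 ^ k)) ⊛ (x ^ˢ (2 ^ k))  ≈⟨ square-lift 2∣2^[1+k] (pow2-lift k x≡1) ⟩
      one                              ∎

open import Data.Nat using (ℕ; _≤_; _^_; _%_; _+_; _*_; suc)
open import Data.Integer using (+_; _-_)
open import Data.Integer.Divisibility using (_∣_)
open import Relation.Binary.PropositionalEquality using (_≡_)
open import Data.Integer.Divisibility.Signed using (∣⇒∣ᵤ)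
open PowerSeries

theorem3p1 : (ζ η m n t : ℕ) → 1 ≤ ζ → 1 ≤ η → 3 ≤ t → t % 2 ≡ 1 →
    (+ (2 ^ (suc ζ))) ∣ (Sbar t (2 ^ ζ * m + η) n - Sbar t η n)
theorem3p1 ζ η m n 0       _ _ () _
theorem3p1 ζ η m n (suc t) _ _ _  _ = ∣⇒∣ᵤ (∣-coeff congruence n)
  where
  open SeriesMod (+ (2 ^ suc ζ))
  G = Sbar-series (suc t) 1
  G^2^ζ≈1 : G ^ˢ (2 ^ ζ) ≈ one
  G^2^ζ≈1 = pow2-lift ζ (Mod2.Sbar-series≈1 t)
  congruence : Sbar-series (suc t) (2 ^ ζ * m + η) ≈ Sbar-series (suc t) η
  congruence = begin
    Sbar-series (suc t) (2 ^ ζ * m + η)  ≈⟨ Sbar-series-^ˢ (suc t) (2 ^ ζ * m + η) ⟨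
    G ^ˢ (2 ^ ζ * m + η)                 ≈⟨ ^ˢ-homo-⊛ G (2 ^ ζ * m) η ⟩
    (G ^ˢ (2 ^ ζ * m)) ⊛ (G ^ˢ η)        ≈⟨ *-congʳ {G ^ˢ η} (^ˢ-assocʳ G (2 ^ ζ) m) ⟨
    ((G ^ˢ (2 ^ ζ)) ^ˢ m) ⊛ (G ^ˢ η)     ≈⟨ *-congʳ {G ^ˢ η} (x≈1⇒x^ˢn≈1 m G^2^ζ≈1) ⟩
    one ⊛ (G ^ˢ η)                       ≈⟨ *-identityˡ (G ^ˢ η) ⟩
    G ^ˢ η                               ≈⟨ Sbar-series-^ˢ (suc t) η ⟩
    Sbar-series (suc t) η                ∎
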